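{- Let $\Psi=\Pi:\varphi$ be a DQBF, $C$ a clause compatible with $\Psi$, and $V'=\mathrm{dep}(C)$. If $\mathrm{abs}(\Pi:\varphi\land\neg C,V')\vdash_{1\forall}\bot$, then $\mathrm{abs}(\Pi:\varphi,V')\equiv\mathrm{abs}(\Pi:\varphi\land C,V')$.
   Context: A DQBF over a finite set $V=\{x_1,\dots,x_n,y_1,\dots,y_m\}$ of Boolean variables has the form $\forall x_1\ldots\forall x_n\exists y_1(D_{y_1})\ldots\exists y_m(D_{y_m}):\varphi$, where $D_{y_i}\subseteq\{x_1,\dots,x_n\}$ and $\varphi$ is a CNF, treated as a set of clauses, each clause a set of literals. The prefix is treated as a set $\Pi$. $V_\exists$ and $V_\forall$ denote the existential and universal variables. A clause is compatible if it only contains variables of the DQBF. A Skolem function is a family $(s_y)_{y\in V_\exists}$ with $s_y:\mathcal{A}(D_y)\to\{0,1\}$ ($\mathcal{A}(X)$ the set of assignments $X\to\{0,1\}$) such that substituting $s_y$ for each $y$ makes the matrix a tautology. Two DQBFs over the same existential and universal variables are equivalent iff they have exactly the same Skolem functions. Dependencies are defined by $\mathrm{dep}(v)=\{v\}$ if $v$ is universal and $\mathrm{dep}(v)=D_v$ if $v$ is existential. For a clause, $\mathrm{dep}(C)=\bigcup_{\ell\in C}\mathrm{dep}(\mathrm{var}(\ell))$. $\Pi:\varphi\land C$ adds clause $C$. $\Pi:\varphi\land\neg C$ adds the unit clauses $\{\neg\ell\}$ for all $\ell\in C$. Abstraction: for $V'\subseteq V_\forall$, $\mathrm{abs}(\Pi:\varphi,V')$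 keeps the matrix and turns each $v\in V'$ into an existential variable $\exists v(\emptyset)$, removing $v$ from all dependency sets. Universal reduction: $\mathrm{UR}(C)$ removes from a non-tautological clause $C$ every universal literal $\ell$ for which no existential literal $k\in C$ has $\mathrm{var}(\ell)\in D_{\mathrm{var}(k)}$. $\mathrm{UR}$ is applied clause-wise to formulas. Unit propagation: with $U$ the set of existential literals $\ell$ with $\{\ell\}\in\varphi$, define $\mathrm{UP}^1(\Pi:\varphi)=\mathrm{UR}\bigl(\Pi\setminus\{\mathrm{var}(\ell)\mid\ell\in U\}:\{C\setminus\{\neg\ell\mid\ell\in U\}\mid C\in\varphi,\ C\cap U=\emptyset\}\bigr)$. Iterate to a fixpoint. $\Pi:\varphi\vdash_{1\forall}\bot$ means the fixpoint contains the empty clause. -}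

module Defs where

open import Data.Nat using (ℕ; zero; suc; _≡ᵇ_)
open import Data.Bool using (Bool; true; false; not; _∧_; _∨_; _xor_; if_then_else_)
open import Data.List using (List; []; _∷_; _++_; map; filterᵇ; concatMap)
open import Data.Bool.ListAction using (any; all)
open import Data.List.Membership.Propositional using (_∈_)
open import Data.List.Relation.Unary.All using (All)
open import Data.List.Relation.Unary.Any using (Any)
open import Data.List.Relation.Unary.Unique.Propositional using (Unique)
open import Data.Product using (_×_; _,_; proj₁; proj₂; ∃)
open import Relation.Binary.PropositionalEquality using (_≡_)

Var : Set
Var = ℕ

-- A literal is a variable with a polarity (true = positive, false = negated).
Lit : Set
Lit = Var × Bool

var : Lit → Var
var = proj₁

neg : Lit → Lit
neg (v , p) = (v , not p)

-- Clauses and CNFs (sets represented by lists; order/multiplicity irrelevant).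
Clause : Set
Clause = List Lit

CNF : Set
CNF = List Clause

-- Prefix: universal variables, and existential variables with their
-- dependency sets D_y.
record Prefix : Set where
  constructor mkPrefix
  field
    univ  : List Var
    exist : List (Var × List Var)
open Prefix public

record DQBF : Set where
  constructor _∶_
  field
    prefix : Prefix
    matrix : CNF
open DQBF public

memᵇ : Var → List Var → Bool
memᵇ v = any (v ≡ᵇ_)

litEqᵇ : Lit → Lit → Bool
litEqᵇ (v , p) (w , q) = (v ≡ᵇ w) ∧ not (p xor q)

isUniv : Prefix → Var → Bool
isUniv Π v = memᵇ v (univ Π)

isExist : Prefix → Var → Bool
isExist Π v = any (λ e → v ≡ᵇ proj₁ e) (exist Π)

-- D_y (empty if y is not an existential of the prefix)
lookupD : List (Var × List Var) → Var → List Var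
lookupD [] y = []
lookupD ((z , D) ∷ es) y = if y ≡ᵇ z then D else lookupD es y

vars : Prefix → List Var
vars Π = univ Π ++ map proj₁ (exist Π)

depVar : Prefix → Var → List Var
depVar Π v = if isUniv Π v then v ∷ [] else lookupD (exist Π) v

depClause : Prefix → Clause → List Var
depClause Π C = concatMap (λ l → depVar Π (var l)) C

Compatible : DQBF → Clause → Set
Compatible Ψ C = All (λ l → var l ∈ vars (prefix Ψ)) C

WellFormed : DQBF → Set
WellFormed Ψ =
  Unique (vars (prefix Ψ)) ×
  All (λ e → All (_∈ univ (prefix Ψ)) (proj₂ e)) (exist (prefix Ψ)) ×
  All (Compatible Ψ) (matrix Ψ)

addClause : DQBF → Clause → DQBF
addClause (Π ∶ φ) C = Π ∶ (C ∷ φ)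

addNegClause : DQBF → Clause → DQBF
addNegClause (Π ∶ φ) C = Π ∶ (map (λ l → neg l ∷ []) C ++ φ)

abs : DQBF → List Var → DQBF
abs (Π ∶ φ) V' =
  mkPrefix (filterᵇ (λ v → not (memᵇ v V')) (univ Π))
           (map (λ e → (proj₁ e , filterᵇ (λ v → not (memᵇ v V')) (proj₂ e))) (exist Π)
            ++ map (λ v → (v , [])) (filterᵇ (λ v → memᵇ v V') (univ Π)))
  ∶ φ

tautologicalᵇ : Clause → Bool
tautologicalᵇ C = any (λ l → any (λ k → litEqᵇ k (neg l)) C) C

keepᵇ : Prefix → Clause → Lit → Bool
keepᵇ Π C l =
  not (isUniv Π (var l)) ∨
  any (λ k → isExist Π (var k) ∧ memᵇ (var l) (lookupD (exist Π) (var k))) C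

URclause : Prefix → Clause → Clause
URclause Π C = if tautologicalᵇ C then C else filterᵇ (keepᵇ Π C) C

UR : DQBF → DQBF
UR (Π ∶ φ) = Π ∶ map (URclause Π) φ

unitLit : Prefix → Clause → List Lit
unitLit Π [] = []
unitLit Π (l ∷ ls) = if isExist Π (var l) ∧ all (litEqᵇ l) ls then l ∷ [] else []

unitLits : DQBF → List Lit
unitLits (Π ∶ φ) = concatMap (unitLit Π) φ

UP¹ : DQBF → DQBF
UP¹ (Π ∶ φ) =
  UR (mkPrefix (univ Π)
               (filterᵇ (λ e → not (any (λ l → proj₁ e ≡ᵇ var l) U)) (exist Π))
      ∶ map (filterᵇ (λ l → not (inU (neg l))))
            (filterᵇ (λ C → not (any inU C)) φ))
  where
    U : List Lit
    U = unitLits (Π ∶ φ)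
    inU : Lit → Bool
    inU l = any (litEqᵇ l) U

iterate : ℕ → (DQBF → DQBF) → DQBF → DQBF
iterate zero    f x = x
iterate (suc n) f x = iterate n f (f x)

-- Π : φ ⊢_{1∀} ⊥ : the fixpoint of UP¹ contains the empty clause.
-- Since the empty clause persists under UP¹ and the UP¹-sequence is
-- eventually constant, this is: some iterate contains the empty clause.
_⊢1∀⊥ : DQBF → Set
Ψ ⊢1∀⊥ = ∃ λ k → [] ∈ matrix (iterate k UP¹ Ψ)

Assignment : Set
Assignment = Var → Bool

evalLit : Assignment → Lit → Bool
evalLit τ (v , p) = not (p xor τ v)

SatClause : Assignment → Clause → Set
SatClause τ C = Any (λ l → evalLit τ l ≡ true) C

SatCNF : Assignment → CNF → Set
SatCNF τ φ = All (SatClause τ) φ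

-- candidate Skolem function family: s y is the function for variable y
-- (given as a function of a full assignment; only its values on
-- existential variables matter)
SkolemFamily : Set
SkolemFamily = Var → Assignment → Bool

-- s_y : A(D_y) → {0,1}, i.e. s y depends only on the variables in D_y
RespectsDeps : Prefix → SkolemFamily → Set
RespectsDeps Π s = ∀ y D → (y , D) ∈ exist Π →
  ∀ (a b : Assignment) → (∀ x → x ∈ D → a x ≡ b x) → s y a ≡ s y b

IsSkolem : DQBF → SkolemFamily → Set
IsSkolem (Π ∶ φ) s =
  RespectsDeps Π s ×
  (∀ (τ : Assignment) → (∀ y D → (y , D) ∈ exist Π → τ y ≡ s y τ) → SatCNF τ φ)

_≡DQBF_ : DQBF → DQBF → Set
Ψ₁ ≡DQBF Ψ₂ = ∀ (s : SkolemFamily) →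
  (IsSkolem Ψ₁ s → IsSkolem Ψ₂ s) × (IsSkolem Ψ₂ s → IsSkolem Ψ₁ s)

-- Adding C can only shrink the set of Skolem functions, so it suffices to show that
-- every Skolem function s of abs(Ψ, V') satisfies C.  Abstracting V' = dep(C) turns
-- every variable of C into an existential with empty dependency set, so all
-- assignments consistent with s agree on C.  If one of them falsified C, all of them
-- would satisfy ¬C, and s would be a Skolem function of abs(Ψ ∧ ¬C, V').  That is
-- impossible, because ⊢1∀ is sound: along the UP¹ sequence every assignment
-- consistent with s still satisfies the matrix, and every existential eliminated by
-- propagation is assigned the same value by all of them.

module Submission where

open import Defs
open import Data.Bool using (Bool; true; false; not; T; if_then_else_; _xor_; _≟_)
open import Data.Bool.Properties using (T-≡; T-∧; T-∨; ¬-not)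
open import Data.Bool.ListAction using (any; all)
open import Data.Nat using (zero; suc; _≡ᵇ_)
open import Data.Nat.Properties using (≡ᵇ⇒≡; ≡⇒≡ᵇ)
open import Data.List using (List; []; _∷_; _++_; map; filterᵇ)
open import Data.List.Properties using (filter-none)
open import Data.List.Membership.Propositional using (_∈_; _∉_; find; lose)
open import Data.List.Membership.Propositional.Properties
  using (∈-++⁻; ∈-++⁺ˡ; ∈-++⁺ʳ; ∈-map⁺; ∈-map⁻; ∈-filter⁺; ∈-filter⁻; ∈-concatMap⁺; ∈-concatMap⁻)
open import Data.List.Relation.Unary.All as All using (All; []; _∷_)
open import Data.List.Relation.Unary.All.Properties as All using (all⁺; ++⁺)
open import Data.List.Relation.Unary.Any as Any using (here; there; any?)
open import Data.List.Relation.Unary.Any.Properties using (any⁺; any⁻; ¬Any[])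
open import Data.List.Relation.Unary.AllPairs using (_∷_)
open import Data.List.Relation.Unary.Unique.Propositional using (Unique)
open import Data.Product using (∃; _×_; _,_; proj₁; proj₂)
open import Data.Sum using (_⊎_; inj₁; inj₂)
open import Function using (_∘_; Equivalence)
open import Relation.Nullary using (¬_; yes; no; contradiction)
open import Relation.Nullary.Decidable using (T?)
open import Relation.Binary.PropositionalEquality
  using (_≡_; _≢_; refl; sym; trans; cong; cong₂; subst; module ≡-Reasoning)

open Equivalence using (to; from)
open ≡-Reasoning

if-T : ∀ {A : Set} {b} {x y : A} → T b → (if b then x else y) ≡ x
if-T {b = true} _ = refl

if-¬T : ∀ {A : Set} {b} {x y : A} → ¬ T b → (if b then x else y) ≡ y
if-¬T {b = true}  ¬t = contradiction _ ¬t
if-¬T {b = false} _  = refl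

T-not⇒¬T : ∀ {b} → T (not b) → ¬ T b
T-not⇒¬T {false} _ ()

¬T⇒T-not : ∀ {b} → ¬ T b → T (not b)
¬T⇒T-not {true}  ¬t = ¬t _
¬T⇒T-not {false} _  = _

¬T-not⇒T : ∀ {b} → ¬ T (not b) → T b
¬T-not⇒T {true}  _   = _
¬T-not⇒T {false} ¬t = ¬t _

memᵇ⇒∈ : ∀ {v} xs → T (memᵇ v xs) → v ∈ xs
memᵇ⇒∈ {v} xs t = Any.map (≡ᵇ⇒≡ v _) (any⁻ (v ≡ᵇ_) xs t)

∈⇒memᵇ : ∀ {v xs} → v ∈ xs → T (memᵇ v xs)
∈⇒memᵇ {v} v∈ = any⁺ (v ≡ᵇ_) (Any.map (≡⇒≡ᵇ v _) v∈)

lookupD-∈ : ∀ es {v} → T (any (λ e → v ≡ᵇ proj₁ e) es) → (v , lookupD es v) ∈ es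
lookupD-∈ ((z , D) ∷ es) {v} t with v ≡ᵇ z in eq
... | true with refl ← ≡ᵇ⇒≡ v z (from T-≡ eq) = here refl
... | false = there (lookupD-∈ es t)

isExist⇒∈ : ∀ Π {v} → T (isExist Π v) → ∃ λ D → (v , D) ∈ exist Π
isExist⇒∈ Π e = _ , lookupD-∈ (exist Π) e

∈⇒isExist : ∀ Π {v D} → (v , D) ∈ exist Π → T (isExist Π v)
∈⇒isExist Π {v} v∈ = any⁺ _ (lose v∈ (≡⇒≡ᵇ v v refl))

xnor⇒≡ : ∀ p q → T (not (p xor q)) → p ≡ q
xnor⇒≡ true  true  _ = refl
xnor⇒≡ false false _ = refl

litEqᵇ⇒≡ : ∀ l k → T (litEqᵇ l k) → l ≡ k
litEqᵇ⇒≡ (v , p) (w , q) t = cong₂ _,_ (≡ᵇ⇒≡ v w (proj₁ (to T-∧ t))) (xnor⇒≡ p q (proj₂ (to T-∧ t)))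

litEqᵇ-refl : ∀ l → T (litEqᵇ l l)
litEqᵇ-refl (v , true)  = from T-∧ (≡⇒≡ᵇ v v refl , _)
litEqᵇ-refl (v , false) = from T-∧ (≡⇒≡ᵇ v v refl , _)

Unique-++⇒disjoint : ∀ {A : Set} {x : A} xs {ys} → Unique (xs ++ ys) → x ∈ xs → x ∉ ys
Unique-++⇒disjoint (_ ∷ xs) (x≢ ∷ _)    (here refl)  x∈ys = All.lookup x≢ (∈-++⁺ʳ xs x∈ys) refl
Unique-++⇒disjoint (_ ∷ xs) (_ ∷ uniq) (there x∈xs)      = Unique-++⇒disjoint xs uniq x∈xs

evalLit-cong : ∀ {τ τ₂ v} p → τ v ≡ τ₂ v → evalLit τ (v , p) ≡ evalLit τ₂ (v , p)
evalLit-cong p = cong (λ b → not (p xor b))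

evalLit-true : ∀ τ {v} p → evalLit τ (v , p) ≡ true → τ v ≡ p
evalLit-true τ {v} p eq with τ v | p | eq
... | true  | true  | _ = refl
... | false | false | _ = refl

evalLit-neg : ∀ τ l → evalLit τ (neg l) ≡ not (evalLit τ l)
evalLit-neg τ (v , p) with τ v | p
... | true  | true  = refl
... | true  | false = refl
... | false | true  = refl
... | false | false = refl

sat-repeated : ∀ {τ k ks} → T (all (litEqᵇ k) ks) → SatClause τ (k ∷ ks) → evalLit τ k ≡ true
sat-repeated          _    (here t) = t
sat-repeated {τ} {k} {ks} same (there t) with find t
... | j , j∈ , tj with refl ← litEqᵇ⇒≡ k j (All.lookup (all⁺ _ ks same) j∈) = tj

unitLit-sound : ∀ Π {τ C l} → SatClause τ C → l ∈ unitLit Π C → evalLit τ l ≡ true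
unitLit-sound Π {C = k ∷ ks} sat l∈ with isExist Π (var k) | all (litEqᵇ k) ks in same
unitLit-sound Π sat (here refl) | true | true = sat-repeated (from T-≡ same) sat

unitLits-sound : ∀ {Π τ φ l} → SatCNF τ φ → l ∈ unitLits (Π ∶ φ) → evalLit τ l ≡ true
unitLits-sound {Π} {φ = φ} sat l∈ with find (∈-concatMap⁻ (unitLit Π) {xs = φ} l∈)
... | C , C∈ , l∈C = unitLit-sound Π (All.lookup sat C∈) l∈C

remove-falsified-sat : ∀ {τ U C} → (∀ {k} → k ∈ U → evalLit τ k ≡ true) → SatClause τ C →
  SatClause τ (filterᵇ (λ l → not (any (litEqᵇ (neg l)) U)) C)
remove-falsified-sat {τ} {U} {C} units sat with find sat
... | l , l∈ , tl = lose (∈-filter⁺ (T? ∘ λ l → not (any (litEqᵇ (neg l)) U)) l∈ kept) tl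
  where
    negation-unassigned : ¬ T (any (litEqᵇ (neg l)) U)
    negation-unassigned t with find (any⁻ _ U t)
    ... | k , k∈ , same with refl ← litEqᵇ⇒≡ (neg l) k same = contradiction (begin
      false              ≡⟨ cong not tl ⟨
      not (evalLit τ l)  ≡⟨ evalLit-neg τ l ⟨
      evalLit τ (neg l)  ≡⟨ units k∈ ⟩
      true               ∎) λ ()
    kept : T (not (any (litEqᵇ (neg l)) U))
    kept = ¬T⇒T-not negation-unassigned

tautological-complementary : ∀ {C l} → l ∈ C → neg l ∈ C → T (tautologicalᵇ C)
tautological-complementary {l = l} l∈ l̄∈ = any⁺ _ (lose l∈ (any⁺ _ (lose l̄∈ (litEqᵇ-refl (neg l)))))

occursNegated : Clause → Var → Bool
occursNegated C v = any (λ k → litEqᵇ k (v , false)) C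

occursNegated-falsifies : ∀ {C v p} → ¬ T (tautologicalᵇ C) → (v , p) ∈ C → occursNegated C v ≢ p
occursNegated-falsifies {C} {v} {false} _ v∈ eq =
  subst T eq (any⁺ _ (lose v∈ (litEqᵇ-refl (v , false))))
occursNegated-falsifies {C} {v} {true} ¬taut v∈ eq with find (any⁻ _ C (subst T (sym eq) _))
... | k , k∈ , same with refl ← litEqᵇ⇒≡ k (v , false) same = ¬taut (tautological-complementary v∈ k∈)

removed⇒universal : ∀ {Π C} l → ¬ T (keepᵇ Π C l) → T (isUniv Π (var l))
removed⇒universal l ¬k = ¬T-not⇒T (¬k ∘ from T-∨ ∘ inj₁)

dependency⇒kept : ∀ {Π C k} l → k ∈ C → T (isExist Π (var k)) →
  var l ∈ lookupD (exist Π) (var k) → T (keepᵇ Π C l)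
dependency⇒kept l k∈ e x∈ = from T-∨ (inj₂ (any⁺ _ (lose k∈ (from T-∧ (e , ∈⇒memᵇ x∈)))))

Consistent : Prefix → SkolemFamily → Assignment → Set
Consistent Π s τ = ∀ y D → (y , D) ∈ exist Π → τ y ≡ s y τ

Determined : Prefix → SkolemFamily → Var → Set
Determined Π s v = ∀ {τ τ₂} → Consistent Π s τ → Consistent Π s τ₂ → τ v ≡ τ₂ v

independent⇒determined : ∀ {Π s y} → RespectsDeps Π s → (y , []) ∈ exist Π → Determined Π s y
independent⇒determined {s = s} {y} rd y∈ {τ} {τ₂} c c₂ = begin
  τ y    ≡⟨ c y [] y∈ ⟩
  s y τ  ≡⟨ rd y [] y∈ τ τ₂ (λ _ ()) ⟩
  s y τ₂ ≡⟨ c₂ y [] y∈ ⟨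
  τ₂ y   ∎

record WellScoped (Π : Prefix) : Set where
  field
    univ-not-exist : ∀ {x} → T (isUniv Π x) → ¬ T (isExist Π x)
    dep-not-exist  : ∀ {y D x} → (y , D) ∈ exist Π → x ∈ D → ¬ T (isExist Π x)

assignUnits : DQBF → DQBF
assignUnits (Π ∶ φ) =
  mkPrefix (univ Π) (filterᵇ (λ e → not (any (λ l → proj₁ e ≡ᵇ var l) U)) (exist Π))
  ∶ map (filterᵇ (λ l → not (any (litEqᵇ (neg l)) U))) (filterᵇ (λ C → not (any assigned C)) φ)
  where
    U : List Lit
    U = unitLits (Π ∶ φ)
    assigned : Lit → Bool
    assigned l = any (litEqᵇ l) U

module Propagation {Π₀ : Prefix} {s : SkolemFamily} (rd : RespectsDeps Π₀ s) (ws : WellScoped Π₀) where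
  open WellScoped ws

  ValidClause : Clause → Set
  ValidClause C = ∀ τ → Consistent Π₀ s τ → SatClause τ C

  Valid : CNF → Set
  Valid φ = ∀ τ → Consistent Π₀ s τ → SatCNF τ φ

  extend : Assignment → Assignment
  extend τ v = if isExist Π₀ v then s v τ else τ v

  extend-off : ∀ τ v → ¬ T (isExist Π₀ v) → extend τ v ≡ τ v
  extend-off τ v = if-¬T

  extend-consistent : ∀ τ → Consistent Π₀ s (extend τ)
  extend-consistent τ y D y∈ = begin
    extend τ y      ≡⟨ if-T (∈⇒isExist Π₀ y∈) ⟩
    s y τ           ≡⟨ rd y D y∈ τ (extend τ) (λ x x∈ → sym (extend-off τ x (dep-not-exist y∈ x∈))) ⟩
    s y (extend τ)  ∎

  record Residual (Π : Prefix) : Set where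
    field
      univ-≡  : univ Π ≡ univ Π₀
      exist-⊆ : ∀ {e} → e ∈ exist Π → e ∈ exist Π₀
      frozen  : ∀ {v} → T (isExist Π₀ v) → ¬ T (isExist Π v) → Determined Π₀ s v

  -- UR only removes universal literals, so τ′ may falsify them while agreeing with τ
  -- on the rest; the consistent extension of τ′ satisfies C, hence a kept literal,
  -- and on kept variables it agrees with τ.
  module Reduct {Π} (res : Residual Π) {C : Clause} (¬taut : ¬ T (tautologicalᵇ C))
                (valid : ValidClause C) (τ : Assignment) (c : Consistent Π₀ s τ) where
    open Residual res

    τ′ : Assignment
    τ′ v = if keepᵇ Π C (v , true) then τ v else occursNegated C v

    removed-value : ∀ {v} → ¬ T (keepᵇ Π C (v , true)) → extend τ′ v ≡ occursNegated C v
    removed-value {v} ¬k = trans (extend-off τ′ v (univ-not-exist {v} universal)) (if-¬T ¬k)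
      where
        universal : T (isUniv Π₀ v)
        universal = subst (λ us → T (memᵇ v us)) univ-≡ (removed⇒universal {Π} {C} (v , true) ¬k)

    kept-value : ∀ {v p} → (v , p) ∈ C → T (keepᵇ Π C (v , true)) → extend τ′ v ≡ τ v
    kept-value {v} v∈ k with T? (isExist Π₀ v)
    ... | no ¬e = trans (extend-off τ′ v ¬e) (if-T k)
    ... | yes e with T? (isExist Π v)
    ...   | no ¬eΠ = frozen e ¬eΠ (extend-consistent τ′) c
    ...   | yes eΠ = begin
      extend τ′ v      ≡⟨ extend-consistent τ′ v D e₀ ⟩
      s v (extend τ′)  ≡⟨ rd v D e₀ (extend τ′) τ agree ⟩
      s v τ            ≡⟨ c v D e₀ ⟨
      τ v              ∎
      where
        D : List Var
        D = lookupD (exist Π) v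
        e₀ : (v , D) ∈ exist Π₀
        e₀ = exist-⊆ (lookupD-∈ (exist Π) eΠ)
        agree : ∀ x → x ∈ D → extend τ′ x ≡ τ x
        agree x x∈ = trans (extend-off τ′ x (dep-not-exist e₀ x∈))
                           (if-T (dependency⇒kept {Π} (x , true) v∈ eΠ x∈))

    reduct-sat : SatClause τ (filterᵇ (keepᵇ Π C) C)
    reduct-sat with find (valid (extend τ′) (extend-consistent τ′))
    ... | (v , p) , v∈ , tv with T? (keepᵇ Π C (v , true))
    ...   | yes k = lose (∈-filter⁺ (T? ∘ keepᵇ Π C) v∈ k)
                         (trans (evalLit-cong {τ} {extend τ′} p (sym (kept-value v∈ k))) tv)
    ...   | no ¬k = contradiction (trans (sym (removed-value {v} ¬k)) (evalLit-true (extend τ′) p tv))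
                                  (occursNegated-falsifies ¬taut v∈)

  URclause-valid : ∀ {Π C} → Residual Π → ValidClause C → ValidClause (URclause Π C)
  URclause-valid {C = C} res valid τ c with T? (tautologicalᵇ C)
  ... | yes taut = subst (SatClause τ) (sym (if-T taut)) (valid τ c)
  ... | no ¬taut = subst (SatClause τ) (sym (if-¬T ¬taut)) (Reduct.reduct-sat res ¬taut valid τ c)

  record Invariant (Φ : DQBF) : Set where
    field
      residual : Residual (prefix Φ)
      valid    : Valid (matrix Φ)

  UR-invariant : ∀ {Φ} → Invariant Φ → Invariant (UR Φ)
  UR-invariant inv = record
    { residual = residual
    ; valid    = λ τ c → All.map⁺ (All.tabulate λ C∈ →
                   URclause-valid residual (λ τ₂ c₂ → All.lookup (valid τ₂ c₂) C∈) τ c)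
    }
    where open Invariant inv

  unit-determined : ∀ {Π φ l} → Valid φ → l ∈ unitLits (Π ∶ φ) → Determined Π₀ s (var l)
  unit-determined {l = v , p} valid l∈ {τ} {τ₂} c c₂ = begin
    τ v   ≡⟨ evalLit-true τ p (unitLits-sound (valid τ c) l∈) ⟩
    p     ≡⟨ evalLit-true τ₂ p (unitLits-sound (valid τ₂ c₂) l∈) ⟨
    τ₂ v  ∎

  assignUnits-residual : ∀ {Φ} → Invariant Φ → Residual (prefix (assignUnits Φ))
  assignUnits-residual {Π ∶ φ} inv = record
    { univ-≡  = univ-≡
    ; exist-⊆ = exist-⊆ ∘ proj₁ ∘ ∈-filter⁻ _
    ; frozen  = frozen′
    }
    where
      open Invariant inv
      open Residual residual
      U : List Lit
      U = unitLits (Π ∶ φ)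
      Π′ : Prefix
      Π′ = prefix (assignUnits (Π ∶ φ))
      removed⇒assigned : ∀ v → T (isExist Π v) → ¬ T (isExist Π′ v) → T (any (λ l → v ≡ᵇ var l) U)
      removed⇒assigned v eΠ ¬e′ = ¬T-not⇒T (¬e′ ∘ ∈⇒isExist Π′ ∘ ∈-filter⁺ _ (lookupD-∈ (exist Π) {v} eΠ))
      frozen′ : ∀ {v} → T (isExist Π₀ v) → ¬ T (isExist Π′ v) → Determined Π₀ s v
      frozen′ {v} e ¬e′ with T? (isExist Π v)
      ... | no ¬e = frozen e ¬e
      ... | yes eΠ with find (any⁻ _ U (removed⇒assigned v eΠ ¬e′))
      ...   | l , l∈ , v≡l with refl ← ≡ᵇ⇒≡ v (var l) v≡l = unit-determined {Π} valid l∈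

  assignUnits-valid : ∀ {Π φ} → Valid φ → Valid (matrix (assignUnits (Π ∶ φ)))
  assignUnits-valid {Π} {φ} valid τ c =
    All.map⁺ (All.map (remove-falsified-sat {U = U} (unitLits-sound (valid τ c)))
                      (All.filter⁺ _ (valid τ c)))
    where
      U : List Lit
      U = unitLits (Π ∶ φ)

  -- UP¹ Φ is definitionally UR (assignUnits Φ).
  UP¹-invariant : ∀ {Φ} → Invariant Φ → Invariant (UP¹ Φ)
  UP¹-invariant inv = UR-invariant record
    { residual = assignUnits-residual inv
    ; valid    = assignUnits-valid (Invariant.valid inv)
    }

  iterate-UP¹-invariant : ∀ k {Φ} → Invariant Φ → Invariant (iterate k UP¹ Φ)
  iterate-UP¹-invariant zero    inv = inv
  iterate-UP¹-invariant (suc k) inv = iterate-UP¹-invariant k (UP¹-invariant inv)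

  invariant⇒¬⊢1∀⊥ : ∀ {Φ} → Invariant Φ → ¬ (Φ ⊢1∀⊥)
  invariant⇒¬⊢1∀⊥ inv (k , []∈) = ¬Any[] (All.lookup (valid τ (extend-consistent (λ _ → true))) []∈)
    where
      open Invariant (iterate-UP¹-invariant k inv)
      τ : Assignment
      τ = extend (λ _ → true)

⊢1∀⊥-sound : ∀ {Φ s} → WellScoped (prefix Φ) → IsSkolem Φ s → ¬ (Φ ⊢1∀⊥)
⊢1∀⊥-sound ws (rd , valid) = invariant⇒¬⊢1∀⊥ record
  { residual = record { univ-≡ = refl ; exist-⊆ = λ e∈ → e∈ ; frozen = λ e ¬e → contradiction e ¬e }
  ; valid    = valid
  }
  where open Propagation rd ws

module Abstraction (Ψ : DQBF) (V' : List Var) where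
  private
    Π₀ : Prefix
    Π₀ = prefix (abs Ψ V')
    U : List Var
    U = univ (prefix Ψ)
    E : List (Var × List Var)
    E = exist (prefix Ψ)
    inside outside : Var → Bool
    inside v = memᵇ v V'
    outside v = not (inside v)
    restrictDeps : Var × List Var → Var × List Var
    restrictDeps (y , D) = y , filterᵇ outside D
    independentEntry : Var → Var × List Var
    independentEntry v = v , []

  abs-existential : ∀ {x} → T (isExist Π₀ x) → x ∈ map proj₁ E ⊎ x ∈ V'
  abs-existential e with isExist⇒∈ Π₀ e
  ... | D , x∈ with ∈-++⁻ (map restrictDeps E) x∈
  ...   | inj₁ m with ∈-map⁻ restrictDeps m
  ...     | _ , e∈ , refl = inj₁ (∈-map⁺ proj₁ e∈)
  abs-existential e | D , x∈ | inj₂ m with ∈-map⁻ independentEntry m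
  ...     | _ , y∈ , refl = inj₂ (memᵇ⇒∈ V' (proj₂ (∈-filter⁻ (T? ∘ inside) {xs = U} y∈)))

  abs-universal-not-exist : Unique (vars (prefix Ψ)) →
                            ∀ {x} → x ∈ U → T (outside x) → ¬ T (isExist Π₀ x)
  abs-universal-not-exist uniq x∈U out e with abs-existential e
  ... | inj₁ x∈keys = Unique-++⇒disjoint U uniq x∈U x∈keys
  ... | inj₂ x∈V'   = T-not⇒¬T out (∈⇒memᵇ x∈V')

  abs-wellScoped : WellFormed Ψ → WellScoped Π₀
  abs-wellScoped (uniq , deps⊆univ , _) = record
    { univ-not-exist = λ {x} u → let x∈U , out = ∈-filter⁻ (T? ∘ outside) {xs = U} (memᵇ⇒∈ {x} _ u) in
                             abs-universal-not-exist uniq x∈U out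
    ; dep-not-exist  = dep-not-exist
    }
    where
      dep-not-exist : ∀ {y D x} → (y , D) ∈ exist Π₀ → x ∈ D → ¬ T (isExist Π₀ x)
      dep-not-exist yD∈ x∈D with ∈-++⁻ (map restrictDeps E) yD∈
      ... | inj₁ m with ∈-map⁻ restrictDeps m
      ...   | _ , e∈ , refl with ∈-filter⁻ (T? ∘ outside) x∈D
      ...     | x∈D₀ , out = abs-universal-not-exist uniq (All.lookup (All.lookup deps⊆univ e∈) x∈D₀) out
      dep-not-exist yD∈ x∈D | inj₂ m with ∈-map⁻ independentEntry m | x∈D
      ... | _ , _ , refl | ()

  abs-independent : ∀ {v} → v ∈ vars (prefix Ψ) → (∀ {x} → x ∈ depVar (prefix Ψ) v → x ∈ V') →
                    (v , []) ∈ exist Π₀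
  abs-independent {v} v∈ deps⊆V' with T? (isUniv (prefix Ψ) v)
  ... | yes u = ∈-++⁺ʳ (map restrictDeps E) (∈-map⁺ independentEntry (∈-filter⁺ (T? ∘ inside) v∈U v∈V'))
    where
      v∈U : v ∈ U
      v∈U = memᵇ⇒∈ U u
      v∈V' : T (inside v)
      v∈V' = ∈⇒memᵇ (deps⊆V' (subst (v ∈_) (sym (if-T u)) (here refl)))
  ... | no ¬u with ∈-++⁻ U v∈
  ...   | inj₁ v∈U = contradiction (∈⇒memᵇ v∈U) ¬u
  ...   | inj₂ v∈keys with ∈-map⁻ proj₁ v∈keys
  ...     | _ , e∈ , refl = ∈-++⁺ˡ (subst (λ D → (v , D) ∈ map restrictDeps E) deps-removed
                                      (∈-map⁺ restrictDeps (lookupD-∈ E (∈⇒isExist (prefix Ψ) e∈))))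
    where
      deps-inside : All (λ x → ¬ T (outside x)) (lookupD E v)
      deps-inside = All.tabulate λ x∈ out → T-not⇒¬T out (∈⇒memᵇ (deps⊆V' (subst (_ ∈_) (sym (if-¬T ¬u)) x∈)))
      deps-removed : filterᵇ outside (lookupD E v) ≡ []
      deps-removed = filter-none (T? ∘ outside) deps-inside

negation-forced : ∀ {Π s C τ τ₂} → RespectsDeps Π s → (∀ {l} → l ∈ C → (var l , []) ∈ exist Π) →
  Consistent Π s τ → ¬ SatClause τ C → Consistent Π s τ₂ → SatCNF τ₂ (map (λ l → neg l ∷ []) C)
negation-forced {Π} {s} {τ = τ} {τ₂} rd independent c unsat c₂ =
  All.map⁺ (All.tabulate λ l∈ → here (falsified l∈))
  where
    falsified : ∀ {l} → l ∈ _ → evalLit τ₂ (neg l) ≡ true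
    falsified {v , p} l∈ = begin
      evalLit τ₂ (neg (v , p))  ≡⟨ evalLit-neg τ₂ (v , p) ⟩
      not (evalLit τ₂ (v , p))  ≡⟨ cong not (evalLit-cong {τ₂} {τ} p same-value) ⟩
      not (evalLit τ (v , p))   ≡⟨ cong not (¬-not (unsat ∘ lose l∈)) ⟩
      true                      ∎
      where
        same-value : τ₂ v ≡ τ v
        same-value = independent⇒determined {Π} {s} rd (independent l∈) c₂ c

mainTheorem9 : (Ψ : DQBF) → WellFormed Ψ → (C : Clause) → Compatible Ψ C →
    abs (addNegClause Ψ C) (depClause (prefix Ψ) C) ⊢1∀⊥ →
    abs Ψ (depClause (prefix Ψ) C) ≡DQBF abs (addClause Ψ C) (depClause (prefix Ψ) C)
mainTheorem9 Ψ wf C compatible refuted s = strengthen , weaken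
  where
    V' : List Var
    V' = depClause (prefix Ψ) C
    Π₀ : Prefix
    Π₀ = prefix (abs Ψ V')
    open Abstraction Ψ V'

    independent : ∀ {l} → l ∈ C → (var l , []) ∈ exist Π₀
    independent l∈ = abs-independent (All.lookup compatible l∈) (λ x∈ → ∈-concatMap⁺ _ (lose l∈ x∈))

    strengthen : IsSkolem (abs Ψ V') s → IsSkolem (abs (addClause Ψ C) V') s
    strengthen (rd , valid) = rd , λ τ c → clause-holds τ c ∷ valid τ c
      where
        clause-holds : ∀ τ → Consistent Π₀ s τ → SatClause τ C
        clause-holds τ c with any? (λ l → evalLit τ l ≟ true) C
        ... | yes sat  = sat
        ... | no unsat = contradiction refuted (⊢1∀⊥-sound (abs-wellScoped wf) (rd , negation-valid))
          where
            negation-valid : ∀ τ₂ → Consistent Π₀ s τ₂ → SatCNF τ₂ (map (λ l → neg l ∷ []) C ++ matrix Ψ)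
            negation-valid τ₂ c₂ = ++⁺ (negation-forced {Π₀} {s} rd independent c unsat c₂) (valid τ₂ c₂)

    weaken : IsSkolem (abs (addClause Ψ C) V') s → IsSkolem (abs Ψ V') s
    weaken (rd , valid) = rd , λ τ c → All.tail (valid τ c)
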